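{- Let $w\in\mathfrak{S}_N$. There are no distinct $k,k'\in\mathrm{newrep}(w)$ for which $\mathfrak{p}_k(w)$ and $\mathfrak{p}_{k'}(w)$ are the same $N$-occurrence of $3412$ in $w$.
   Context: Permutations are written in one-line notation; $s_i$ is the simple reflection interchanging $i$ and $i+1$; $\mathrm{supp}(u)$ is the set of distinct simple reflections appearing in a reduced decomposition of $u$. An occurrence of a pattern $p\in\mathfrak{S}_k$ in $w$ is a subsequence $w(i_1)\cdots w(i_k)$, $i_1<\cdots<i_k$, in the same relative order as $p$; it is identified with its set of values $\{w(i_1),\dots,w(i_k)\}$, and is an $N$-occurrence if its largest value is $N$. For $w\in\mathfrak{S}_N$, $\overline{w}\in\mathfrak{S}_{N-1}$ is obtained by deleting the letter $N$ from the one-line notation of $w$. For $u\in\mathfrak{S}_n$ and $1\le k\le n-1$, $M_k(u)=\max\{u(1),\dots,u(k)\}$, $m_k(u)=\min\{u(k+1),\dots,u(n)\}$; write $M_k=M_k(\overline{w})$, $m_k=m_k(\overline{w})$. Let $\mathrm{newrep}(w)=\{k:\ s_k\in\mathrm{supp}(\overline{w}),\ w^{ -1}(N)\le k\}$. For $k\in\mathrm{newrep}(w)$ define: (I) if $w^{ -1}(N)<w^{ -1}(M_k)$, $\mathfrak{p}_k(w)=\{N,M_k,m_k\}$ (an $N$-occurrence of $321$); (II) if $w^{ -1}(N)>w^{ -1}(M_k)$ and $\overline{w}(k)>m_k$, $\mathfrak{p}_k(w)=\{N,\overline{w}(k),m_k\}$ (an $N$-occurrence of $321$); (III) otherwise $\mathfrak{p}_k(w)=\{M_k,N,\overline{w}(k),m_k\}$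 (an $N$-occurrence of $3412$). -}

module Defs where

open import Data.Nat using (ℕ; zero; suc; _≤_; _<_; _⊔_; _⊓_; _≡ᵇ_; _<ᵇ_)
open import Data.Bool using (Bool; true; false; if_then_else_)
open import Data.List using (List; []; _∷_; length; take; drop; foldr; foldl; applyUpTo)
open import Data.List.Relation.Unary.All using (All)
open import Data.List.Membership.Propositional using (_∈_)
open import Data.List.Relation.Binary.Permutation.Propositional using (_↭_)
open import Data.Product using (_×_; ∃)
open import Function.Bundles using (_⇔_)

-- Conventions: permutations are lists in one-line notation; positions
-- and values are 1-indexed natural numbers.

idList : ℕ → List ℕ
idList n = applyUpTo suc n

IsPerm : ℕ → List ℕ → Set
IsPerm N w = w ↭ idList N

-- u(i), 1-indexed (0 outside the range)
entry : List ℕ → ℕ → ℕ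
entry []       _             = 0
entry (x ∷ xs) zero          = 0
entry (x ∷ xs) (suc zero)    = x
entry (x ∷ xs) (suc (suc i)) = entry xs (suc i)

pos : ℕ → List ℕ → ℕ
pos v []       = 0
pos v (x ∷ xs) = if x ≡ᵇ v then 1 else suc (pos v xs)

deleteVal : ℕ → List ℕ → List ℕ
deleteVal v []       = []
deleteVal v (x ∷ xs) = if x ≡ᵇ v then deleteVal v xs else x ∷ deleteVal v xs

wbar : ℕ → List ℕ → List ℕ
wbar N w = deleteVal N w

-- right multiplication by s_k: swap the entries in positions k, k+1
swapAt : ℕ → List ℕ → List ℕ
swapAt zero          xs           = xs
swapAt (suc zero)    (x ∷ y ∷ xs) = y ∷ x ∷ xs
swapAt (suc zero)    xs           = xs
swapAt (suc (suc k)) []           = []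
swapAt (suc (suc k)) (x ∷ xs)     = x ∷ swapAt (suc k) xs

Represents : ℕ → List ℕ → List ℕ → Set
Represents n word u =
  All (λ i → (1 ≤ i) × (suc i ≤ n)) word × (foldl (λ v i → swapAt i v) (idList n) word ≡ u)
  where open import Relation.Binary.PropositionalEquality using (_≡_)

Reduced : ℕ → List ℕ → List ℕ → Set
Reduced n word u =
  Represents n word u × (∀ word' → Represents n word' u → length word ≤ length word')

InSupp : ℕ → List ℕ → Set
InSupp k u = ∃ λ word → Reduced (length u) word u × (k ∈ word)

Mk : ℕ → List ℕ → ℕ
Mk k u = foldr _⊔_ 0 (take k u)

-- m_k(u) = min{u(k+1),…,u(n)}  (fold seed length u + 1 exceeds every
-- value of u ∈ 𝔖_n, so it is neutral; the range is nonempty for k ≤ n-1)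
mk : ℕ → List ℕ → ℕ
mk k u = foldr _⊓_ (suc (length u)) (drop k u)

InNewrep : ℕ → List ℕ → ℕ → Set
InNewrep N w k = InSupp k (wbar N w) × (pos N w ≤ k)

-- 𝔭_k(w), as a list of values (identified with the set of its values)
pk : ℕ → List ℕ → ℕ → List ℕ
pk N w k =
  if pos N w <ᵇ pos M w then N ∷ M ∷ m ∷ []
  else if m <ᵇ entry wb k then N ∷ entry wb k ∷ m ∷ []
  else M ∷ N ∷ entry wb k ∷ m ∷ []
  where
    wb = wbar N w
    M  = Mk k wb
    m  = mk k wb

SameSet : List ℕ → List ℕ → Set
SameSet A B = ∀ x → (x ∈ A) ⇔ (x ∈ B)

IsNOcc3412 : ℕ → List ℕ → List ℕ → Set
IsNOcc3412 N w S =
  ∃ λ i₁ → ∃ λ i₂ → ∃ λ i₃ → ∃ λ i₄ →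
    (1 ≤ i₁) × (i₁ < i₂) × (i₂ < i₃) × (i₃ < i₄) × (i₄ ≤ length w) ×
    (entry w i₃ < entry w i₄) × (entry w i₄ < entry w i₁) × (entry w i₁ < entry w i₂) ×
    (entry w i₂ ≡ N) ×
    SameSet S (entry w i₁ ∷ entry w i₂ ∷ entry w i₃ ∷ entry w i₄ ∷ [])
  where open import Relation.Binary.PropositionalEquality using (_≡_)

-- If 𝔭_k(w) is an occurrence of 3412 then it comes from case (III), so it
-- contains w̄(k) together with M_k ≥ w̄(k) and m_k ≥ w̄(k); the least value of
-- the occurrence lies below N, hence is w̄(k). Thus the occurrence determines
-- the value w̄(k), and with it k, since w̄ has no repeated letters.
module Submission where

open import Defs
open import Data.Nat using (ℕ; zero; suc; _≤_; _<_; _≡ᵇ_; _<ᵇ_; z≤n; s≤s)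
open import Data.Nat.Properties
open import Data.Bool using (true; false; T)
open import Data.List using (List; []; _∷_; length)
open import Data.List.Membership.Propositional using (_∈_)
open import Data.List.Relation.Binary.Subset.Propositional using (_⊆_)
open import Data.List.Relation.Unary.Any using (here; there)
open import Data.List.Relation.Unary.All using (All; []; _∷_; lookup)
open import Data.List.Relation.Unary.Unique.Propositional using (Unique; []; _∷_)
open import Data.List.Relation.Unary.Unique.Propositional.Properties using (applyUpTo⁺₁)
open import Data.List.Relation.Binary.Permutation.Propositional using (↭-sym; ↭⇒↭ₛ)
open import Data.List.Relation.Binary.Permutation.Setoid.Properties as ↭ₛ using ()
open import Data.Product using (_×_; _,_; ∃; proj₁; proj₂)
open import Data.Sum using (_⊎_; inj₁; inj₂)
open import Data.Empty using (⊥; ⊥-elim)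
open import Function using (_∘_)
open import Function.Bundles using (Equivalence)
open import Function.Properties.Equivalence using () renaming (sym to ⇔-sym)
open import Relation.Nullary using (¬_)
open import Relation.Binary.PropositionalEquality
  using (_≡_; _≢_; refl; sym; cong; subst; setoid)

ValidIndex : List ℕ → ℕ → Set
ValidIndex xs i = 1 ≤ i × i ≤ length xs

IsLeast : List ℕ → ℕ → Set
IsLeast S x = x ∈ S × (∀ {y} → y ∈ S → x ≤ y)

IsLeast-unique : ∀ {S x y} → IsLeast S x → IsLeast S y → x ≡ y
IsLeast-unique (x∈S , x-least) (y∈S , y-least) = ≤-antisym (x-least y∈S) (y-least x∈S)

IsLeast-resp-SameSet : ∀ {S T x} → SameSet S T → IsLeast S x → IsLeast T x
IsLeast-resp-SameSet S≈T (x∈S , x-least) =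
  Equivalence.to (S≈T _) x∈S , x-least ∘ Equivalence.from (S≈T _)

Unique-idList : ∀ N → Unique (idList N)
Unique-idList N = applyUpTo⁺₁ suc N (λ i<j _ → <⇒≢ i<j ∘ suc-injective)

Unique-perm : ∀ {N w} → IsPerm N w → Unique w
Unique-perm w↭id = ↭ₛ.Unique-resp-↭ (setoid ℕ) (↭⇒↭ₛ (↭-sym w↭id)) (Unique-idList _)

All-deleteVal : ∀ {P : ℕ → Set} v xs → All P xs → All P (deleteVal v xs)
All-deleteVal v []       []         = []
All-deleteVal v (x ∷ xs) (px ∷ pxs) with x ≡ᵇ v
... | true  = All-deleteVal v xs pxs
... | false = px ∷ All-deleteVal v xs pxs

Unique-deleteVal : ∀ v {xs} → Unique xs → Unique (deleteVal v xs)
Unique-deleteVal v {[]}     []           = []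
Unique-deleteVal v {x ∷ xs} (x∉xs ∷ uxs) with x ≡ᵇ v
... | true  = Unique-deleteVal v uxs
... | false = All-deleteVal v xs x∉xs ∷ Unique-deleteVal v uxs

entry-∈ : ∀ xs {i} → ValidIndex xs i → entry xs i ∈ xs
entry-∈ (x ∷ xs) {suc zero}    _            = here refl
entry-∈ (x ∷ xs) {suc (suc i)} (_ , s≤s i≤) = there (entry-∈ xs (s≤s z≤n , i≤))

entry-injective : ∀ {xs i j} → Unique xs → ValidIndex xs i → ValidIndex xs j →
                  entry xs i ≡ entry xs j → i ≡ j
entry-injective {x ∷ xs} {suc zero}    {suc zero}    _ _ _ _ = refl
entry-injective {x ∷ xs} {suc zero}    {suc (suc j)} (x∉xs ∷ _) _ (_ , s≤s j≤) x≡ =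
  ⊥-elim (lookup x∉xs (entry-∈ xs (s≤s z≤n , j≤)) x≡)
entry-injective {x ∷ xs} {suc (suc i)} {suc zero}    (x∉xs ∷ _) (_ , s≤s i≤) _ ≡x =
  ⊥-elim (lookup x∉xs (entry-∈ xs (s≤s z≤n , i≤)) (sym ≡x))
entry-injective {x ∷ xs} {suc (suc i)} {suc (suc j)} (_ ∷ uxs) (_ , s≤s i≤) (_ , s≤s j≤) eq =
  cong suc (entry-injective uxs (s≤s z≤n , i≤) (s≤s z≤n , j≤) eq)

entry≤Mk : ∀ u {k} → ValidIndex u k → entry u k ≤ Mk k u
entry≤Mk (x ∷ xs) {suc zero}    _            = m≤m⊔n x 0
entry≤Mk (x ∷ xs) {suc (suc k)} (_ , s≤s k≤) = m≤n⇒m≤o⊔n x (entry≤Mk xs (s≤s z≤n , k≤))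

newrep-ValidIndex : ∀ N w {k} → InNewrep N w k → ValidIndex (wbar N w) k
newrep-ValidIndex _ _ ((word , ((letters-in-range , _) , _) , k∈word) , _)
  with lookup letters-in-range k∈word
... | 1≤k , k<n = 1≤k , <⇒≤ k<n

Values3412 : ℕ → List ℕ → Set
Values3412 N S = ∃ λ a → ∃ λ c → ∃ λ d →
  c < d × d < a × a < N × SameSet S (a ∷ N ∷ c ∷ d ∷ [])

NOcc3412⇒Values3412 : ∀ {N} w {S} → IsNOcc3412 N w S → Values3412 N S
NOcc3412⇒Values3412 _ (_ , _ , _ , _ , _ , _ , _ , _ , _ , c<d , d<a , a<N , refl , S≈) =
  _ , _ , _ , c<d , d<a , a<N , S≈

3412-least : ∀ {a N c d} → c < d → d < a → a < N → IsLeast (a ∷ N ∷ c ∷ d ∷ []) c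
3412-least {a} {N} {c} {d} c<d d<a a<N = there (there (here refl)) , c≤
  where
    c<a = <-trans c<d d<a
    c≤ : ∀ {y} → y ∈ a ∷ N ∷ c ∷ d ∷ [] → c ≤ y
    c≤ (here refl)                         = <⇒≤ c<a
    c≤ (there (here refl))                 = <⇒≤ (<-trans c<a a<N)
    c≤ (there (there (here refl)))         = ≤-refl
    c≤ (there (there (there (here refl)))) = <⇒≤ c<d

no-chain-in-pair : ∀ {c d a p q : ℕ} → c < d → d < a →
                   c ∈ p ∷ q ∷ [] → d ∈ p ∷ q ∷ [] → a ∈ p ∷ q ∷ [] → ⊥
no-chain-in-pair c<d _   (here refl)         (here refl)         _ = <-irrefl refl c<d
no-chain-in-pair c<d _   (there (here refl)) (there (here refl)) _ = <-irrefl refl c<d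
no-chain-in-pair _   d<a _ (here refl)         (here refl)         = <-irrefl refl d<a
no-chain-in-pair _   d<a _ (there (here refl)) (there (here refl)) = <-irrefl refl d<a
no-chain-in-pair c<d d<a (here refl)         (there (here refl)) (here refl)         =
  <-irrefl refl (<-trans c<d d<a)
no-chain-in-pair c<d d<a (there (here refl)) (here refl)         (there (here refl)) =
  <-irrefl refl (<-trans c<d d<a)

triple-¬Values3412 : ∀ {N p q} → ¬ Values3412 N (N ∷ p ∷ q ∷ [])
triple-¬Values3412 {N} {p} {q} (a , c , d , c<d , d<a , a<N , S≈) =
  no-chain-in-pair c<d d<a
    (below-N c<N (from (there (there (here refl)))))
    (below-N d<N (from (there (there (there (here refl))))))
    (below-N a<N (from (here refl)))
  where
    d<N = <-trans d<a a<N
    c<N = <-trans c<d d<N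
    from : a ∷ N ∷ c ∷ d ∷ [] ⊆ N ∷ p ∷ q ∷ []
    from = Equivalence.from (S≈ _)
    below-N : ∀ {y N xs} → y < N → y ∈ N ∷ xs → y ∈ xs
    below-N y<N (here refl) = ⊥-elim (<-irrefl refl y<N)
    below-N _   (there y∈)  = y∈

caseIII-least : ∀ {M N x m} → x ≤ M → x ≤ m → Values3412 N (M ∷ N ∷ x ∷ m ∷ []) →
                IsLeast (M ∷ N ∷ x ∷ m ∷ []) x
caseIII-least {M} {N} {x} {m} x≤M x≤m (a , c , d , c<d , d<a , a<N , S≈) =
  there (there (here refl)) , λ y∈ → ≤-trans (x≤ c<N (proj₁ c-least)) (proj₂ c-least y∈)
  where
    c-least : IsLeast (M ∷ N ∷ x ∷ m ∷ []) c
    c-least = IsLeast-resp-SameSet (⇔-sym ∘ S≈) (3412-least c<d d<a a<N)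
    c<N = <-trans c<d (<-trans d<a a<N)
    x≤ : ∀ {y} → y < N → y ∈ M ∷ N ∷ x ∷ m ∷ [] → x ≤ y
    x≤ _   (here refl)                         = x≤M
    x≤ N<N (there (here refl))                 = ⊥-elim (<-irrefl refl N<N)
    x≤ _   (there (there (here refl)))         = ≤-refl
    x≤ _   (there (there (there (here refl)))) = x≤m

pk-cases : ∀ N w k → let wb = wbar N w; x = entry wb k; m = mk k wb in
  (∃ λ p → ∃ λ q → pk N w k ≡ N ∷ p ∷ q ∷ []) ⊎
  (pk N w k ≡ Mk k wb ∷ N ∷ x ∷ m ∷ [] × x ≤ m)
pk-cases N w k with pos N w <ᵇ pos (Mk k (wbar N w)) w
... | true = inj₁ (_ , _ , refl)
... | false with mk k (wbar N w) <ᵇ entry (wbar N w) k in m<ᵇx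
...   | true  = inj₁ (_ , _ , refl)
...   | false = inj₂ (refl , ≮⇒≥ (λ m<x → subst T m<ᵇx (<⇒<ᵇ m<x)))

pk-3412-least : ∀ N w k → ValidIndex (wbar N w) k → Values3412 N (pk N w k) →
                IsLeast (pk N w k) (entry (wbar N w) k)
pk-3412-least N w k valid values with pk-cases N w k
... | inj₁ (p , q , pk≡) = ⊥-elim (triple-¬Values3412 (subst (Values3412 N) pk≡ values))
... | inj₂ (pk≡ , x≤m)   = subst (λ S → IsLeast S (entry (wbar N w) k)) (sym pk≡)
  (caseIII-least (entry≤Mk _ valid) x≤m (subst (Values3412 N) pk≡ values))

proposition4p1p1 : ∀ (N : ℕ) (w : List ℕ) → IsPerm N w →
    ∀ (k k′ : ℕ) → InNewrep N w k → InNewrep N w k′ → k ≢ k′ →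
    ¬ (IsNOcc3412 N w (pk N w k) × IsNOcc3412 N w (pk N w k′) × SameSet (pk N w k) (pk N w k′))
proposition4p1p1 N w w-perm k k′ k-new k′-new k≢k′ (occ , occ′ , pk≈pk′) =
  k≢k′ (entry-injective (Unique-deleteVal N (Unique-perm w-perm)) valid valid′
         (IsLeast-unique (IsLeast-resp-SameSet pk≈pk′ least) least′))
  where
    valid : ValidIndex (wbar N w) k
    valid = newrep-ValidIndex N w k-new
    valid′ : ValidIndex (wbar N w) k′
    valid′ = newrep-ValidIndex N w k′-new
    least : IsLeast (pk N w k) (entry (wbar N w) k)
    least = pk-3412-least N w k valid (NOcc3412⇒Values3412 w occ)
    least′ : IsLeast (pk N w k′) (entry (wbar N w) k′)
    least′ = pk-3412-least N w k′ valid′ (NOcc3412⇒Values3412 w occ′)
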